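{- Let $k\ge 3$ and $n\ge k$, and suppose $W^{(k)}_n$ has a bordering palindrome of type $j$ for some $j$ with $n-k+2\le j\le n-1$. Then $n\le 2k-3$ and $n-k+2\le j\le k-1$.
   Context: The alphabet is $\mathbb{N}=\{0,1,2,\dots\}$. For an integer $k\ge 3$, $\varphi_k$ is the morphism of $\mathbb{N}^*$ defined on letters, for $i\ge 0$ and $0\le j\le k-1$, by $\varphi_k(ki+j)=(ki)(ki+j+1)$ (two letters) if $0\le j\le k-2$, and $\varphi_k(ki+k-1)=(ki+k)$ (one letter). For $n\ge 0$, $W^{(k)}_n=\varphi_k^n(0)$; for $W=w_1\cdots w_m$, $W[s,t]=w_s\cdots w_t$. For $n\ge k$ and $n-k+1\le j\le n$, put $e_j=\sum_{i=j}^{n-1}|W^{(k)}_i|$ (so $e_n=0$); these are the boundaries of the blocks in the factorization $W^{(k)}_n=W^{(k)}_{n-1}W^{(k)}_{n-2}\cdots W^{(k)}_{n-k+1}(k\oplus W^{(k)}_{n-k})$, where $k\oplus W$ adds $k$ to every letter of $W$. For $n-k+2\le j\le n-1$, a bordering palindrome of type $j$ of $W^{(k)}_n$ is a pair $(s,t)$ with $e_{j+1}<s\le e_j<t\le e_{n-k+1}$ such that $W^{(k)}_n[s,t]$ is a palindrome (it consists of a nonempty suffix of the block $W^{(k)}_j$ followed by a nonempty prefix of $W^{(k)}_{j-1}\cdots W^{(k)}_{n-k+1}$). -}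

module Defs where

open import Data.Nat using (ℕ; zero; suc; _+_; _*_; _∸_; _≤_; _<_; _≤ᵇ_)
open import Data.Nat.DivMod using (_/_; _%_)
open import Data.Bool using (if_then_else_)
open import Data.List using (List; []; _∷_; _++_; concatMap; length; take; drop; reverse; map; upTo)
open import Data.Nat.ListAction using (sum)
open import Relation.Binary.PropositionalEquality using (_≡_)
open import Data.Product using (_×_; ∃₂)

-- The morphism φ_k on a single letter a = k*i + j (i = a / k, j = a % k):
--   φ_k(ki+j) = (ki)(ki+j+1) if j ≤ k-2, and φ_k(ki+k-1) = ki+k = a+1.
-- Only meaningful for k ≥ 1 (the statement assumes k ≥ 3); for k = 0 we
-- return an arbitrary value.
φletter : ℕ → ℕ → List ℕ
φletter zero    a = a ∷ []
φletter (suc m) a =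
  if (a % suc m) ≤ᵇ (m ∸ 1)
  then (suc m * (a / suc m)) ∷ (a + 1) ∷ []
  else (a + 1) ∷ []

φ : ℕ → List ℕ → List ℕ
φ k w = concatMap (φletter k) w

φ^ : ℕ → ℕ → List ℕ → List ℕ
φ^ k zero    w = w
φ^ k (suc n) w = φ k (φ^ k n w)

W : ℕ → ℕ → List ℕ
W k n = φ^ k n (0 ∷ [])

-- W[s,t] = w_s ⋯ w_t  (1-indexed, inclusive)
factor : List ℕ → ℕ → ℕ → List ℕ
factor w s t = take (suc t ∸ s) (drop (s ∸ 1) w)

IsPalindrome : List ℕ → Set
IsPalindrome w = reverse w ≡ w

sumRange : (ℕ → ℕ) → ℕ → ℕ → ℕ
sumRange f a b = sum (map (λ i → f (a + i)) (Data.List.upTo (b ∸ a)))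
  where import Data.List

e : ℕ → ℕ → ℕ → ℕ
e k n j = sumRange (λ i → length (W k i)) j n

BorderingPalindrome : ℕ → ℕ → ℕ → ℕ → ℕ → Set
BorderingPalindrome k n j s t =
  e k n (suc j) < s × s ≤ e k n j × e k n j < t × t ≤ e k n (suc (n ∸ k))
  × IsPalindrome (factor (W k n) s t)

HasBorderingPalindrome : ℕ → ℕ → ℕ → Set
HasBorderingPalindrome k n j = ∃₂ λ s t → BorderingPalindrome k n j s t

-- Put c = n - k + 1.  Because φ_k(d) = 0 (d+1) for d < k - 1, the prefix of W_n of length
-- e_c is W_{n-1} ⋯ W_c (φ^-telescope).  A bordering palindrome of type j lies inside
-- W_j W_{j-1} ⋯ W_c, whose letters are all < j except the last letter j of W_j; so the
-- palindrome is centred on that letter and the part of W_j before it mirrors a nonempty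
-- prefix of W_{j-1} ⋯ W_c.  That prefix starts with 0, so the penultimate letter of W_j
-- would be 0, which fails as soon as j ≥ k.  Hence j ≤ k - 1, and n ≤ j + k - 2 ≤ 2k - 3.
module Submission where

open import Defs
open import Data.Nat
open import Data.Nat.Properties
open import Data.Nat.DivMod using (_/_; _%_; m<n⇒m/n≡0; m<n⇒m%n≡m; m/n*n≤m; m≥n⇒m/n>0)
open import Data.Nat.ListAction using (sum)
open import Data.Nat.ListAction.Properties using (sum-++)
open import Data.Bool using (true; false; T)
open import Data.List using (List; []; _∷_; _++_; _∷ʳ_; length; take; drop; reverse; map; upTo)
open import Data.List.Properties
  using (concatMap-++; ++-assoc; ++-identityʳ; ∷ʳ-++; map-++; upTo-∷ʳ; length-++; length-drop;
         take++drop≡id; reverse-++; unfold-reverse; ∷-injectiveˡ; ∷-injectiveʳ; ∷ʳ-injectiveʳ)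
open import Data.List.Relation.Unary.All as All using (All; []; _∷_)
import Data.List.Relation.Unary.All.Properties as All
import Data.List.Relation.Unary.Any.Properties as Any
open import Data.Product using (∃; ∃₂; _×_; _,_)
open import Data.Sum using (_⊎_; inj₁; inj₂)
open import Data.Empty using (⊥-elim)
open import Relation.Nullary using (¬_; yes; no)
open import Relation.Binary.PropositionalEquality

φ-++ : ∀ k xs ys → φ k (xs ++ ys) ≡ φ k xs ++ φ k ys
φ-++ k = concatMap-++ (φletter k)

φ^-++ : ∀ k c xs ys → φ^ k c (xs ++ ys) ≡ φ^ k c xs ++ φ^ k c ys
φ^-++ k zero    xs ys = refl
φ^-++ k (suc c) xs ys = trans (cong (φ k) (φ^-++ k c xs ys)) (φ-++ k (φ^ k c xs) (φ^ k c ys))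

φ^-suc : ∀ k c w → φ^ k (suc c) w ≡ φ^ k c (φ k w)
φ^-suc k zero    w = refl
φ^-suc k (suc c) w = cong (φ k) (φ^-suc k c w)

φletter-< : ∀ {k a} → suc a < k → φletter k a ≡ 0 ∷ suc a ∷ []
φletter-< {suc m} {a} a+1<k with (a % suc m) ≤ᵇ (m ∸ 1) in eq
... | true  rewrite m<n⇒m/n≡0 {a} {suc m} (<-trans (n<1+n a) a+1<k) | *-zeroʳ m | +-comm a 1 = refl
... | false = ⊥-elim (subst T eq (≤⇒≤ᵇ a%k≤m-1))
  where
  a%k≤m-1 : a % suc m ≤ m ∸ 1
  a%k≤m-1 rewrite m<n⇒m%n≡m (<-trans (n<1+n a) a+1<k) = pred-mono-≤ (s≤s⁻¹ a+1<k)

φletter-cases : ∀ m a →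
  (a % suc m ≤ m ∸ 1 × φletter (suc m) a ≡ suc m * (a / suc m) ∷ suc a ∷ [])
  ⊎ φletter (suc m) a ≡ suc a ∷ []
φletter-cases m a with (a % suc m) ≤ᵇ (m ∸ 1) in eq
... | true  = inj₁ (≤ᵇ⇒≤ _ _ (subst T (sym eq) _) , cong (λ b → suc m * (a / suc m) ∷ b ∷ []) (+-comm a 1))
... | false = inj₂ (cong (_∷ []) (+-comm a 1))

-- When φ_k(a) has two letters, a is not k - 1; so k ≤ a + 1 forces k ≤ a.
φletter-head-nonzero : ∀ m a → let k = suc (suc m) in
  a % k ≤ m → k ≤ suc a → 0 < k * (a / k)
φletter-head-nonzero m a a%k≤m k≤a+1 with a <? suc (suc m)
... | yes a<k = ⊥-elim (<-irrefl refl (≤-trans k≤a+1 (s≤s (subst (_≤ m) (m<n⇒m%n≡m a<k) a%k≤m))))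
... | no  a≮k = ≤-trans (s≤s z≤n) (*-monoʳ-≤ (suc (suc m)) (m≥n⇒m/n>0 (≮⇒≥ a≮k)))

φletter-init : ∀ m a → ∃ λ Z → φletter (suc m) a ≡ Z ∷ʳ suc a × All (_≤ a) Z
φletter-init m a with φletter-cases m a
... | inj₁ (_ , eq) = _ ∷ [] , eq , ≤-trans (≤-reflexive (*-comm (suc m) _)) (m/n*n≤m a (suc m)) ∷ []
... | inj₂ eq       = [] , eq , []

φletter-≤ : ∀ k a → All (_≤ suc a) (φletter k a)
φletter-≤ zero    a = n≤1+n a ∷ []
φletter-≤ (suc m) a with φletter-init m a
... | Z , eq , Z≤a = subst (All (_≤ suc a)) (sym eq) (All.++⁺ (All.map (m≤n⇒m≤1+n) Z≤a) (≤-refl ∷ []))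

φ-≤ : ∀ k {b} xs → All (_≤ b) xs → All (_≤ suc b) (φ k xs)
φ-≤ k []       []         = []
φ-≤ k (x ∷ xs) (x≤b ∷ xs≤b) = All.++⁺ (All.map (λ z≤x+1 → ≤-trans z≤x+1 (s≤s x≤b)) (φletter-≤ k x)) (φ-≤ k xs xs≤b)

W-≤ : ∀ k n → All (_≤ n) (W k n)
W-≤ k zero    = z≤n ∷ []
W-≤ k (suc n) = φ-≤ k (W k n) (W-≤ k n)

W-head : ∀ {k} n → 1 < k → ∃ λ R → W k n ≡ 0 ∷ R
W-head zero    1<k = [] , refl
W-head {k} (suc n) 1<k with W-head n 1<k
... | R , eq = _ , trans (cong (φ k) eq) (cong (_++ φ k R) (φletter-< 1<k))

W-last : ∀ m n → let k = suc (suc m) in ∃₂ λ X y →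
  W k (suc n) ≡ X ∷ʳ y ∷ʳ suc n × All (_≤ n) X × y ≤ n × (k ≤ suc n → 0 < y)
W-last m zero = [] , 0 , cong (_++ []) (φletter-< {suc (suc m)} (s≤s (s≤s z≤n))) , [] , z≤n , λ { (s≤s ()) }
W-last m (suc n) with W-last m n
... | X , y , eq , X≤n , y≤n , _ with φletter-cases (suc m) (suc n)
...   | inj₁ (n+1%k≤m , eqn) =
  φ k X ++ φletter k y , k * (suc n / k) ,
  (begin
    φ k (W k (suc n))                              ≡⟨ cong (φ k) eq ⟩
    φ k (X ∷ʳ y ∷ʳ suc n)                          ≡⟨ φ-++ k (X ∷ʳ y) (suc n ∷ []) ⟩
    φ k (X ∷ʳ y) ++ φletter k (suc n) ++ []        ≡⟨ cong₂ (λ u w → u ++ w ++ []) (φ-++ k X (y ∷ [])) eqn ⟩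
    (φ k X ++ φletter k y ++ []) ++ k * (suc n / k) ∷ suc (suc n) ∷ []
                                                   ≡⟨ cong (λ u → (φ k X ++ u) ++ k * (suc n / k) ∷ suc (suc n) ∷ []) (++-identityʳ (φletter k y)) ⟩
    (φ k X ++ φletter k y) ++ k * (suc n / k) ∷ suc (suc n) ∷ []
                                                   ≡⟨ ∷ʳ-++ (φ k X ++ φletter k y) (k * (suc n / k)) (suc (suc n) ∷ []) ⟨
    (φ k X ++ φletter k y) ∷ʳ k * (suc n / k) ∷ʳ suc (suc n) ∎) ,
  All.++⁺ (φ-≤ k X X≤n) (All.map (λ z≤y+1 → ≤-trans z≤y+1 (s≤s y≤n)) (φletter-≤ k y)) ,
  ≤-trans (≤-reflexive (*-comm k (suc n / k))) (m/n*n≤m (suc n) k) ,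
  φletter-head-nonzero m (suc n) n+1%k≤m
  where open ≡-Reasoning
        k = suc (suc m)
...   | inj₂ eqn with φletter-init (suc m) y
...     | Z , eqy , Z≤y =
  φ k X ++ Z , suc y ,
  (begin
    φ k (W k (suc n))                              ≡⟨ cong (φ k) eq ⟩
    φ k (X ∷ʳ y ∷ʳ suc n)                          ≡⟨ φ-++ k (X ∷ʳ y) (suc n ∷ []) ⟩
    φ k (X ∷ʳ y) ++ φletter k (suc n) ++ []        ≡⟨ cong₂ (λ u w → u ++ w ++ []) (φ-++ k X (y ∷ [])) eqn ⟩
    (φ k X ++ φletter k y ++ []) ++ suc (suc n) ∷ []
                                                   ≡⟨ cong (λ u → (φ k X ++ u) ∷ʳ suc (suc n)) (trans (++-identityʳ (φletter k y)) eqy) ⟩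
    (φ k X ++ (Z ∷ʳ suc y)) ∷ʳ suc (suc n)         ≡⟨ cong (_∷ʳ suc (suc n)) (++-assoc (φ k X) Z (suc y ∷ [])) ⟨
    (φ k X ++ Z) ∷ʳ suc y ∷ʳ suc (suc n) ∎) ,
  All.++⁺ (φ-≤ k X X≤n) (All.map (λ z≤y → ≤-trans z≤y (m≤n⇒m≤1+n y≤n)) Z≤y) ,
  s≤s y≤n ,
  (λ _ → s≤s z≤n)
  where open ≡-Reasoning
        k = suc (suc m)

blocks : ℕ → ℕ → ℕ → List ℕ
blocks k c zero    = []
blocks k c (suc m) = W k (c + m) ++ blocks k c m

φ^-telescope : ∀ {k} c m d → d + m < k →
  φ^ k (c + m) (d ∷ []) ≡ blocks k c m ++ φ^ k c (d + m ∷ [])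
φ^-telescope c zero d _ rewrite +-identityʳ c | +-identityʳ d = refl
φ^-telescope {k} c (suc m) d d+m+1<k = begin
  φ^ k (c + suc m) (d ∷ [])                     ≡⟨ cong (λ i → φ^ k i (d ∷ [])) (+-suc c m) ⟩
  φ^ k (suc (c + m)) (d ∷ [])                   ≡⟨ φ^-suc k (c + m) (d ∷ []) ⟩
  φ^ k (c + m) (φ k (d ∷ []))                   ≡⟨ cong (λ w → φ^ k (c + m) (w ++ [])) (φletter-< d+1<k) ⟩
  φ^ k (c + m) (0 ∷ suc d ∷ [])                 ≡⟨ φ^-++ k (c + m) (0 ∷ []) (suc d ∷ []) ⟩
  W k (c + m) ++ φ^ k (c + m) (suc d ∷ [])      ≡⟨ cong (W k (c + m) ++_) (φ^-telescope c m (suc d) d+1+m<k) ⟩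
  W k (c + m) ++ blocks k c m ++ φ^ k c (suc d + m ∷ [])
                                                ≡⟨ ++-assoc (W k (c + m)) _ _ ⟨
  blocks k c (suc m) ++ φ^ k c (suc d + m ∷ []) ≡⟨ cong (λ i → blocks k c (suc m) ++ φ^ k c (i ∷ [])) (+-suc d m) ⟨
  blocks k c (suc m) ++ φ^ k c (d + suc m ∷ []) ∎
  where
  open ≡-Reasoning
  d+1+m<k : suc d + m < k
  d+1+m<k = subst (_< k) (+-suc d m) d+m+1<k
  d+1<k : suc d < k
  d+1<k = ≤-<-trans (m≤m+n (suc d) m) d+1+m<k

blocks-suc : ∀ k c m → blocks k c (suc m) ≡ blocks k (suc c) m ++ W k c
blocks-suc k c zero    rewrite +-identityʳ c = ++-identityʳ (W k c)
blocks-suc k c (suc m) = begin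
  W k (c + suc m) ++ blocks k c (suc m)           ≡⟨ cong₂ (λ i w → W k i ++ w) (+-suc c m) (blocks-suc k c m) ⟩
  W k (suc c + m) ++ blocks k (suc c) m ++ W k c  ≡⟨ ++-assoc (W k (suc c + m)) _ _ ⟨
  blocks k (suc c) (suc m) ++ W k c ∎
  where open ≡-Reasoning

blocks-+ : ∀ k c m p → blocks k c (m + p) ≡ blocks k (c + m) p ++ blocks k c m
blocks-+ k c m zero    rewrite +-identityʳ m = refl
blocks-+ k c m (suc p) = begin
  blocks k c (m + suc p)                                 ≡⟨ cong (blocks k c) (+-suc m p) ⟩
  W k (c + (m + p)) ++ blocks k c (m + p)                ≡⟨ cong₂ (λ i w → W k i ++ w) (sym (+-assoc c m p)) (blocks-+ k c m p) ⟩
  W k (c + m + p) ++ blocks k (c + m) p ++ blocks k c m  ≡⟨ ++-assoc (W k (c + m + p)) _ _ ⟨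
  blocks k (c + m) (suc p) ++ blocks k c m ∎
  where open ≡-Reasoning

blocks-split : ∀ k {c i n} → c ≤ i → i ≤ n →
  blocks k c (n ∸ c) ≡ blocks k i (n ∸ i) ++ blocks k c (i ∸ c)
blocks-split k {c} {i} {n} c≤i i≤n = begin
  blocks k c (n ∸ c)                          ≡⟨ cong (blocks k c) (trans (cong (_∸ c) (sym (m+[n∸m]≡n i≤n))) (+-∸-comm (n ∸ i) c≤i)) ⟩
  blocks k c ((i ∸ c) + (n ∸ i))              ≡⟨ blocks-+ k c (i ∸ c) (n ∸ i) ⟩
  blocks k (c + (i ∸ c)) (n ∸ i) ++ blocks k c (i ∸ c)
                                              ≡⟨ cong (λ x → blocks k x (n ∸ i) ++ blocks k c (i ∸ c)) (m+[n∸m]≡n c≤i) ⟩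
  blocks k i (n ∸ i) ++ blocks k c (i ∸ c)    ∎
  where open ≡-Reasoning

blocks-peel : ∀ k {i n} → i < n → blocks k i (n ∸ i) ≡ blocks k (suc i) (n ∸ suc i) ++ W k i
blocks-peel k {i} {n} i<n = trans (cong (blocks k i) (+-∸-assoc 1 i<n)) (blocks-suc k i (n ∸ suc i))

blocks-< : ∀ k c m → All (_< c + m) (blocks k c m)
blocks-< k c zero    = []
blocks-< k c (suc m) = subst (λ b → All (_< b) (blocks k c (suc m))) (sym (+-suc c m))
  (All.++⁺ (All.map s≤s (W-≤ k (c + m))) (All.map m≤n⇒m≤1+n (blocks-< k c m)))

blocks-head : ∀ {k} c {i} → 1 < k → c < i → ∃ λ B → blocks k c (i ∸ c) ≡ 0 ∷ B
blocks-head {k} c {i} 1<k c<i with W-head (c + (i ∸ suc c)) 1<k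
... | R , eq = R ++ blocks k c (i ∸ suc c) ,
  trans (cong (blocks k c) (+-∸-assoc 1 c<i)) (cong (_++ blocks k c (i ∸ suc c)) eq)

e≡length-blocks : ∀ k n i → e k n i ≡ length (blocks k i (n ∸ i))
e≡length-blocks k n i = sum-lengths (n ∸ i)
  where
  sum-lengths : ∀ m → sum (map (λ x → length (W k (i + x))) (upTo m)) ≡ length (blocks k i m)
  sum-lengths zero    = refl
  sum-lengths (suc m) = begin
    sum (map ℓ (upTo (suc m)))               ≡⟨ cong (λ xs → sum (map ℓ xs)) (upTo-∷ʳ m) ⟨
    sum (map ℓ (upTo m ∷ʳ m))                ≡⟨ cong sum (map-++ ℓ (upTo m) (m ∷ [])) ⟩
    sum (map ℓ (upTo m) ++ ℓ m ∷ [])         ≡⟨ sum-++ (map ℓ (upTo m)) (ℓ m ∷ []) ⟩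
    sum (map ℓ (upTo m)) + (ℓ m + 0)         ≡⟨ cong₂ _+_ (sum-lengths m) (+-identityʳ (ℓ m)) ⟩
    length (blocks k i m) + ℓ m              ≡⟨ +-comm (length (blocks k i m)) (ℓ m) ⟩
    ℓ m + length (blocks k i m)              ≡⟨ length-++ (W k (i + m)) ⟨
    length (blocks k i (suc m)) ∎
    where
    open ≡-Reasoning
    ℓ : ℕ → ℕ
    ℓ x = length (W k (i + x))

W-factorization : ∀ k {c j n} → c ≤ j → j < n → n ∸ c < k →
  ∃₂ λ P C → W k n ≡ ((P ++ W k j) ++ blocks k c (j ∸ c)) ++ C
    × e k n (suc j) ≡ length P
    × e k n j ≡ length (P ++ W k j)
    × e k n c ≡ length ((P ++ W k j) ++ blocks k c (j ∸ c))
W-factorization k {c} {j} {n} c≤j j<n n∸c<k =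
  P , C , word ,
  e≡length-blocks k n (suc j) ,
  trans (e≡length-blocks k n j) (cong length (blocks-peel k j<n)) ,
  trans (e≡length-blocks k n c) (cong length prefix)
  where
  open ≡-Reasoning
  P = blocks k (suc j) (n ∸ suc j)
  C = φ^ k c (n ∸ c ∷ [])
  prefix : blocks k c (n ∸ c) ≡ (P ++ W k j) ++ blocks k c (j ∸ c)
  prefix = trans (blocks-split k c≤j (<⇒≤ j<n)) (cong (_++ blocks k c (j ∸ c)) (blocks-peel k j<n))
  word : W k n ≡ ((P ++ W k j) ++ blocks k c (j ∸ c)) ++ C
  word = begin
    W k n                                        ≡⟨ cong (λ i → φ^ k i (0 ∷ [])) (m+[n∸m]≡n (≤-trans c≤j (<⇒≤ j<n))) ⟨
    φ^ k (c + (n ∸ c)) (0 ∷ [])                  ≡⟨ φ^-telescope c (n ∸ c) 0 n∸c<k ⟩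
    blocks k c (n ∸ c) ++ C                      ≡⟨ cong (_++ C) prefix ⟩
    ((P ++ W k j) ++ blocks k c (j ∸ c)) ++ C    ∎

module _ {A : Set} where

  drop-length-++ : ∀ (xs ys : List A) n → drop (length xs + n) (xs ++ ys) ≡ drop n ys
  drop-length-++ []       ys n = refl
  drop-length-++ (x ∷ xs) ys n = drop-length-++ xs ys n

  drop-++-≤ : ∀ (xs ys : List A) {n} → n ≤ length xs → drop n (xs ++ ys) ≡ drop n xs ++ ys
  drop-++-≤ xs       ys {zero}  _        = refl
  drop-++-≤ (x ∷ xs) ys {suc n} (s≤s n≤) = drop-++-≤ xs ys n≤

  take-length-++ : ∀ (xs ys : List A) n → take (length xs + n) (xs ++ ys) ≡ xs ++ take n ys
  take-length-++ []       ys n = refl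
  take-length-++ (x ∷ xs) ys n = cong (x ∷_) (take-length-++ xs ys n)

  take-++-≤ : ∀ (xs ys : List A) {n} → n ≤ length xs → take n (xs ++ ys) ≡ take n xs
  take-++-≤ xs       ys {zero}  _        = refl
  take-++-≤ (x ∷ xs) ys {suc n} (s≤s n≤) = cong (x ∷_) (take-++-≤ xs ys n≤)

  length-∷ʳ : ∀ (xs : List A) x → length (xs ∷ʳ x) ≡ suc (length xs)
  length-∷ʳ xs x = trans (length-++ xs) (+-comm (length xs) 1)

  All-reverse : ∀ {P : A → Set} {xs} → All P xs → All P (reverse xs)
  All-reverse Pxs = All.tabulate (λ x∈ → All.lookup Pxs (Any.reverse⁻ x∈))

factor-straddle : ∀ (P L R : List ℕ) i v → i ≤ length L →
  factor ((P ++ L) ++ R) (suc (length P + i)) (length (P ++ L) + v) ≡ drop i L ++ take v R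
factor-straddle P L R i v i≤ = begin
  take (length (P ++ L) + v ∸ (length P + i)) (drop (length P + i) ((P ++ L) ++ R))
    ≡⟨ cong₂ take width (trans (cong (drop (length P + i)) (++-assoc P L R)) (drop-length-++ P (L ++ R) i)) ⟩
  take (length (drop i L) + v) (drop i (L ++ R))
    ≡⟨ cong (take (length (drop i L) + v)) (drop-++-≤ L R i≤) ⟩
  take (length (drop i L) + v) (drop i L ++ R)
    ≡⟨ take-length-++ (drop i L) R v ⟩
  drop i L ++ take v R ∎
  where
  open ≡-Reasoning
  width : length (P ++ L) + v ∸ (length P + i) ≡ length (drop i L) + v
  width = begin
    length (P ++ L) + v ∸ (length P + i)  ≡⟨ cong (λ l → l + v ∸ (length P + i)) (length-++ P) ⟩
    length P + length L + v ∸ (length P + i) ≡⟨ cong (_∸ (length P + i)) (+-assoc (length P) (length L) v) ⟩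
    length P + (length L + v) ∸ (length P + i) ≡⟨ [m+n]∸[m+o]≡n∸o (length P) (length L + v) i ⟩
    length L + v ∸ i                      ≡⟨ +-∸-comm v i≤ ⟩
    length L ∸ i + v                      ≡⟨ cong (_+ v) (length-drop i L) ⟨
    length (drop i L) + v ∎

split-at-bound-unique : ∀ {j} U U' {V V'} → All (_< j) U → All (_< j) U' →
  U ++ j ∷ V ≡ U' ++ j ∷ V' → U ≡ U'
split-at-bound-unique []      []        _            _             eq = refl
split-at-bound-unique []      (u' ∷ U') _            (u'<j ∷ _)    eq = ⊥-elim (<-irrefl (sym (∷-injectiveˡ eq)) u'<j)
split-at-bound-unique (u ∷ U) []        (u<j ∷ _)    _             eq = ⊥-elim (<-irrefl (∷-injectiveˡ eq) u<j)
split-at-bound-unique (u ∷ U) (u' ∷ U') (_ ∷ U<j)    (_ ∷ U'<j)    eq =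
  cong₂ _∷_ (∷-injectiveˡ eq) (split-at-bound-unique U U' U<j U'<j (∷-injectiveʳ eq))

palindrome-around-bound : ∀ {j} U V → All (_< j) U → All (_< j) V →
  IsPalindrome (U ++ j ∷ V) → U ≡ reverse V
palindrome-around-bound {j} U V U<j V<j pal =
  split-at-bound-unique U (reverse V) U<j (All-reverse V<j) (trans (sym pal) reversed)
  where
  reversed : reverse (U ++ j ∷ V) ≡ reverse V ++ j ∷ reverse U
  reversed = begin
    reverse (U ++ j ∷ V)         ≡⟨ reverse-++ U (j ∷ V) ⟩
    reverse (j ∷ V) ++ reverse U ≡⟨ cong (_++ reverse U) (unfold-reverse j V) ⟩
    reverse V ∷ʳ j ++ reverse U  ≡⟨ ∷ʳ-++ (reverse V) j (reverse U) ⟩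
    reverse V ++ j ∷ reverse U   ∎
    where open ≡-Reasoning

crossing-not-palindrome : ∀ {j y} X B i v → All (_< j) (X ∷ʳ y) → 0 < y → All (_< j) (0 ∷ B) →
  i ≤ length (X ∷ʳ y) → ¬ IsPalindrome (drop i (X ∷ʳ y ∷ʳ j) ++ take (suc v) (0 ∷ B))
crossing-not-palindrome {j} {y} X B i v Xy<j 0<y (0<j ∷ B<j) i≤ pal =
  <⇒≢ 0<y (∷ʳ-injectiveʳ (take i (X ∷ʳ y) ++ reverse V) X ends-with-0)
  where
  U = drop i (X ∷ʳ y)
  V = take v B
  U≡rev : U ≡ reverse (0 ∷ V)
  U≡rev = palindrome-around-bound U (0 ∷ V) (All.drop⁺ i Xy<j) (0<j ∷ All.take⁺ v B<j)
    (subst IsPalindrome (trans (cong (_++ 0 ∷ V) (drop-++-≤ (X ∷ʳ y) (j ∷ []) i≤)) (∷ʳ-++ U j (0 ∷ V))) pal)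
  ends-with-0 : (take i (X ∷ʳ y) ++ reverse V) ∷ʳ 0 ≡ X ∷ʳ y
  ends-with-0 = begin
    (take i (X ∷ʳ y) ++ reverse V) ∷ʳ 0  ≡⟨ ++-assoc (take i (X ∷ʳ y)) (reverse V) (0 ∷ []) ⟩
    take i (X ∷ʳ y) ++ reverse V ∷ʳ 0    ≡⟨ cong (take i (X ∷ʳ y) ++_) (unfold-reverse 0 V) ⟨
    take i (X ∷ʳ y) ++ reverse (0 ∷ V)   ≡⟨ cong (take i (X ∷ʳ y) ++_) U≡rev ⟨
    take i (X ∷ʳ y) ++ U                 ≡⟨ take++drop≡id i (X ∷ʳ y) ⟩
    X ∷ʳ y                               ∎
    where open ≡-Reasoning

straddling-not-palindrome : ∀ {j y s t} P X B C → let L = X ∷ʳ y ∷ʳ j in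
  All (_< j) (X ∷ʳ y) → 0 < y → All (_< j) (0 ∷ B) →
  length P < s → s ≤ length (P ++ L) → length (P ++ L) < t → t ≤ length ((P ++ L) ++ 0 ∷ B) →
  ¬ IsPalindrome (factor (((P ++ L) ++ 0 ∷ B) ++ C) s t)
straddling-not-palindrome {j} {y} {s} {t} P X B C Xy<j 0<y 0B<j P<s s≤PL PL<t t≤PLB pal =
  crossing-not-palindrome X B i v Xy<j 0<y 0B<j i≤Xy
    (subst IsPalindrome factor≡ (subst₂ (λ s t → IsPalindrome (factor (((P ++ L) ++ 0 ∷ B) ++ C) s t)) s≡ t≡ pal))
  where
  L = X ∷ʳ y ∷ʳ j
  i = s ∸ suc (length P)
  v = t ∸ suc (length (P ++ L))
  s≡ : s ≡ suc (length P + i)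
  s≡ = sym (m+[n∸m]≡n P<s)
  t≡ : t ≡ length (P ++ L) + suc v
  t≡ = trans (sym (m+[n∸m]≡n PL<t)) (sym (+-suc (length (P ++ L)) v))
  length-PL : length (P ++ L) ≡ length P + suc (length (X ∷ʳ y))
  length-PL = trans (length-++ P) (cong (length P +_) (length-∷ʳ (X ∷ʳ y) j))
  i≤Xy : i ≤ length (X ∷ʳ y)
  i≤Xy = s≤s⁻¹ (+-cancelˡ-≤ (length P) _ _
           (subst₂ _≤_ (trans s≡ (sym (+-suc (length P) i))) length-PL s≤PL))
  i≤L : i ≤ length L
  i≤L = subst (i ≤_) (sym (length-∷ʳ (X ∷ʳ y) j)) (m≤n⇒m≤1+n i≤Xy)
  v≤B : suc v ≤ length (0 ∷ B)
  v≤B = +-cancelˡ-≤ (length (P ++ L)) _ _ (subst₂ _≤_ t≡ (length-++ (P ++ L)) t≤PLB)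
  factor≡ : factor (((P ++ L) ++ 0 ∷ B) ++ C) (suc (length P + i)) (length (P ++ L) + suc v)
            ≡ drop i L ++ take (suc v) (0 ∷ B)
  factor≡ = begin
    factor (((P ++ L) ++ 0 ∷ B) ++ C) (suc (length P + i)) (length (P ++ L) + suc v)
      ≡⟨ cong (λ w → factor w (suc (length P + i)) (length (P ++ L) + suc v)) (++-assoc (P ++ L) (0 ∷ B) C) ⟩
    factor ((P ++ L) ++ 0 ∷ B ++ C) (suc (length P + i)) (length (P ++ L) + suc v)
      ≡⟨ factor-straddle P L (0 ∷ B ++ C) i (suc v) i≤L ⟩
    drop i L ++ take (suc v) (0 ∷ B ++ C)
      ≡⟨ cong (drop i L ++_) (take-++-≤ (0 ∷ B) C v≤B) ⟩
    drop i L ++ take (suc v) (0 ∷ B) ∎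
    where open ≡-Reasoning

no-bordering-palindrome-beyond-k : ∀ m n j → let k = suc (suc m) in
  k ≤ n → n ∸ k + 2 ≤ j → j < n → k ≤ j → ¬ HasBorderingPalindrome k n j
no-bordering-palindrome-beyond-k m n zero     _   _     _   ()
no-bordering-palindrome-beyond-k m n (suc j') k≤n c+1≤j j<n k≤j (s , t , e₁<s , s≤e₀ , e₀<t , t≤e₂ , pal) =
  let (P , C , W≡ , e₁≡ , e₀≡ , e₂≡) = W-factorization k {c} {j} {n} (<⇒≤ c<j) j<n n∸c<k
      (X , y , Wj≡ , X≤j' , y≤j' , 0<y) = W-last m j'
      (B , B≡) = blocks-head {k} c 1<k c<j
      L = X ∷ʳ y ∷ʳ j
      e₀≡′ : e k n j ≡ length (P ++ L)
      e₀≡′ = trans e₀≡ (cong (λ w → length (P ++ w)) Wj≡)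
      e₂≡′ : e k n c ≡ length ((P ++ L) ++ 0 ∷ B)
      e₂≡′ = trans e₂≡ (cong₂ (λ w b → length ((P ++ w) ++ b)) Wj≡ B≡)
      W≡′ : W k n ≡ ((P ++ L) ++ 0 ∷ B) ++ C
      W≡′ = trans W≡ (cong₂ (λ w b → ((P ++ w) ++ b) ++ C) Wj≡ B≡)
      0B<j : All (_< j) (0 ∷ B)
      0B<j = subst (All (_< j)) B≡
               (subst (λ b → All (_< b) (blocks k c (j ∸ c))) (m+[n∸m]≡n (<⇒≤ c<j)) (blocks-< k c (j ∸ c)))
  in straddling-not-palindrome P X B C (All.∷ʳ⁺ (All.map s≤s X≤j') (s≤s y≤j')) (0<y k≤j) 0B<j
       (subst (_< s) e₁≡ e₁<s) (subst (s ≤_) e₀≡′ s≤e₀) (subst (_< t) e₀≡′ e₀<t) (subst (t ≤_) e₂≡′ t≤e₂)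
       (subst (λ w → IsPalindrome (factor w s t)) W≡′ pal)
  where
  k = suc (suc m)
  j = suc j'
  c = suc (n ∸ k)
  1<k : 1 < k
  1<k = s≤s (s≤s z≤n)
  c<j : c < j
  c<j = subst (_≤ j) (+-comm (n ∸ k) 2) c+1≤j
  n∸c<k : n ∸ c < k
  n∸c<k = subst (_< k) (trans (cong pred (sym (m∸[m∸n]≡n k≤n))) (pred[m∸n]≡m∸[1+n] n (n ∸ k))) ≤-refl

n∸k+2≤k∸1⇒n≤2k∸3 : ∀ k' n → let k = 3 + k' in k ≤ n → n ∸ k + 2 ≤ k ∸ 1 → n ≤ 2 * k ∸ 3
n∸k+2≤k∸1⇒n≤2k∸3 k' n k≤n lo = begin
  n              ≡⟨ m∸n+n≡m k≤n ⟨
  n ∸ k + k      ≤⟨ +-monoˡ-≤ k n∸k≤k' ⟩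
  k' + k         ≡⟨ cong (k' +_) (+-identityʳ k) ⟨
  k' + (k + 0)   ∎
  where
  open ≤-Reasoning
  k = 3 + k'
  n∸k≤k' : n ∸ k ≤ k'
  n∸k≤k' = s≤s⁻¹ (s≤s⁻¹ (subst (_≤ 2 + k') (+-comm (n ∸ k) 2) lo))

lemma5p6 : (k n j : ℕ) → 3 ≤ k → k ≤ n →
    n ∸ k + 2 ≤ j → j ≤ n ∸ 1 →
    HasBorderingPalindrome k n j →
    n ≤ 2 * k ∸ 3 × n ∸ k + 2 ≤ j × j ≤ k ∸ 1
lemma5p6 (suc (suc (suc k'))) zero     j (s≤s (s≤s (s≤s z≤n))) () lo hi bp
lemma5p6 (suc (suc (suc k'))) (suc n') j (s≤s (s≤s (s≤s z≤n))) k≤n lo hi bp with j ≤? suc (suc k')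
... | yes j≤k-1 = n∸k+2≤k∸1⇒n≤2k∸3 k' (suc n') k≤n (≤-trans lo j≤k-1) , lo , j≤k-1
... | no  j≰k-1 = ⊥-elim (no-bordering-palindrome-beyond-k (suc k') (suc n') j k≤n lo (s≤s hi) (≰⇒> j≰k-1) bp)
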